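{- A 2-hybrid evolutionary network is 1-nested if and only if it is a weakly galled tree.
   Context: An evolutionary network is a rooted directed acyclic graph whose leaves are bijectively labeled by a set of taxa. A hybrid node is a node of in-degree at least 2; a network is 2-hybrid when every hybrid node has in-degree 2. A reticulation cycle for a hybrid node $h$ is a pair of distinct non-trivial directed paths with a common origin (the split node), both ending in $h$ (the end), that have no intermediate (non-endpoint) nodes in common; its intermediate nodes are those of the two paths. A network is 1-nested when every pair of reticulation cycles with different ends have disjoint sets of intermediate nodes, and a weakly galled tree when every pair of distinct reticulation cycles have disjoint sets of arcs. -}

module Defs where

open import Data.Nat using (ℕ; zero; suc; _+_; _≥_)
open import Data.Fin using (Fin)
open import Data.Bool using (Bool; true; false; if_then_else_)
open import Data.List using (List; []; _∷_; _++_; map; allFin)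
open import Data.Nat.ListAction using (sum)
open import Data.List.Membership.Propositional using (_∈_)
open import Data.Product using (Σ; _×_; _,_)
open import Data.Sum using (_⊎_)
open import Data.Empty using (⊥)
open import Relation.Nullary using (¬_)
open import Relation.Binary.PropositionalEquality using (_≡_; _≢_)
open import Function.Bundles using (_⤖_)

Graph : ℕ → Set
Graph n = Fin n → Fin n → Bool

module _ {n : ℕ} (E : Graph n) where

  Arc : Fin n → Fin n → Set
  Arc u v = E u v ≡ true

  indeg : Fin n → ℕ
  indeg v = sum (map (λ u → if E u v then 1 else 0) (allFin n))

  outdeg : Fin n → ℕ
  outdeg u = sum (map (λ v → if E u v then 1 else 0) (allFin n))

  -- Path x y is : a non-trivial directed path from x to y whose list of
  -- intermediate (non-endpoint) nodes, in order, is `is`.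
  data Path : Fin n → Fin n → List (Fin n) → Set where
    arc  : ∀ {x y} → Arc x y → Path x y []
    step : ∀ {x z y is} → Arc x z → Path z y is → Path x y (z ∷ is)

  Acyclic : Set
  Acyclic = ∀ x is → ¬ Path x x is

  IsLeaf : Fin n → Set
  IsLeaf v = outdeg v ≡ 0

arcsOf : ∀ {n} → Fin n → Fin n → List (Fin n) → List (Fin n × Fin n)
arcsOf x y []       = (x , y) ∷ []
arcsOf x y (z ∷ is) = (x , z) ∷ arcsOf z y is

Disjoint : ∀ {A : Set} → List A → List A → Set
Disjoint xs ys = ∀ {a} → a ∈ xs → a ∈ ys → ⊥

record EvolNet (X : Set) : Set where
  field
    n        : ℕ
    E        : Graph n
    acyclic  : Acyclic E
    root     : Fin n
    root-in0 : indeg E root ≡ 0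
    root-unique : ∀ v → indeg E v ≡ 0 → v ≡ root
    labelling : Σ (Fin n) (IsLeaf E) ⤖ X

module _ {X : Set} (N : EvolNet X) where
  open EvolNet N

  IsHybrid : Fin n → Set
  IsHybrid v = indeg E v ≥ 2

  TwoHybrid : Set
  TwoHybrid = ∀ v → IsHybrid v → indeg E v ≡ 2

  -- A path with fixed
  -- endpoints is identified by its list of intermediate nodes.
  record RetCycle : Set where
    field
      split : Fin n
      end   : Fin n
      int₁  : List (Fin n)
      int₂  : List (Fin n)
      path₁ : Path E split end int₁
      path₂ : Path E split end int₂
      distinct : int₁ ≢ int₂
      noCommon : Disjoint int₁ int₂

  open RetCycle

  intermediates : RetCycle → List (Fin n)
  intermediates C = int₁ C ++ int₂ C

  arcs : RetCycle → List (Fin n × Fin n)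
  arcs C = arcsOf (split C) (end C) (int₁ C) ++ arcsOf (split C) (end C) (int₂ C)

  SameCycle : RetCycle → RetCycle → Set
  SameCycle C D = split C ≡ split D × end C ≡ end D ×
                  ((int₁ C ≡ int₁ D × int₂ C ≡ int₂ D) ⊎ (int₁ C ≡ int₂ D × int₂ C ≡ int₁ D))

  OneNested : Set
  OneNested = ∀ (C D : RetCycle) → end C ≢ end D → Disjoint (intermediates C) (intermediates D)

  WeaklyGalledTree : Set
  WeaklyGalledTree = ∀ (C D : RetCycle) → ¬ SameCycle C D → Disjoint (arcs C) (arcs D)

module Submission where

-- Both directions rest on the fact that a node v with two distinct parents
-- a, b is the end of a reticulation cycle using the arc (a , v)
-- (hybridCycle): walk from the root to a and to b and split the two walks at
-- the last node they share.
--
-- Weakly galled ⇒ 1-nested: a node interior to two cycles with different ends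
-- is entered, inside each of them, by some arc; the two arcs are equal (then the
-- cycles share it) or the node is a hybrid whose own cycle shares an arc with
-- one of them.
--
-- 1-nested ⇒ weakly galled: cycles with different ends share no arc
-- (arcDisjoint); the only delicate case, an arc entering the end of one cycle
-- and lying on the other, is excluded by rerouting the second cycle through
-- the first (finalArcNotShared).  Consequently interior nodes of cycles have a
-- single parent (interiorTreeNodes), so two cycles with the same end, which in
-- a 2-hybrid network enter it through the same two arcs, coincide when traced
-- backwards (uniqueCycle).

open import Defs
open import Function.Bundles using (_⇔_; mk⇔)
open import Function.Base using (_∘_; id)
open import Data.Nat using (ℕ; suc; _+_; _≤_; s≤s; z≤n)
open import Data.Nat.Properties using (+-comm; +-assoc; ≤-trans; n≮n)
open import Data.Nat.ListAction using (sum)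
open import Data.Fin using (Fin; _≟_)
import Data.Fin as Fin
open import Data.Fin.Induction using (spo-wellFounded)
open import Data.Bool using (true; false; if_then_else_)
open import Data.List using (List; []; _∷_; _++_; map; allFin; tabulate)
open import Data.List.Properties using (map-tabulate; ++-identityʳ; ++-assoc)
open import Data.List.Relation.Unary.Any using (here; there)
open import Data.List.Membership.Propositional using (_∈_)
open import Data.List.Membership.Propositional.Properties using (∈-∃++; ∈-++⁺ˡ; ∈-++⁺ʳ; ∈-++⁻)
import Data.List.Membership.DecPropositional as DecMembership
open import Data.List.Relation.Binary.Subset.Propositional using (_⊆_)
open import Data.Product using (Σ; ∃; _×_; _,_; proj₁; proj₂)
open import Data.Sum using (_⊎_; inj₁; inj₂)
import Data.Sum as Sum
open import Data.Empty using (⊥; ⊥-elim)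
open import Relation.Nullary using (yes; no; does)
open import Relation.Binary.PropositionalEquality
  using (_≡_; _≢_; refl; sym; trans; cong; subst; isEquivalence; ≢-sym; module ≡-Reasoning)
open import Induction.WellFounded using (Acc; acc; WellFounded)

disjoint-sym : ∀ {A : Set} {xs ys : List A} → Disjoint xs ys → Disjoint ys xs
disjoint-sym apart k l = apart l k

disjoint-++ˡ : ∀ {A : Set} xs {ys zs : List A} →
               Disjoint xs zs → Disjoint ys zs → Disjoint (xs ++ ys) zs
disjoint-++ˡ xs apart₁ apart₂ k l with ∈-++⁻ xs k
... | inj₁ k′ = apart₁ k′ l
... | inj₂ k′ = apart₂ k′ l

disjoint-++ʳ : ∀ {A : Set} {xs : List A} ys {zs} →
               Disjoint xs ys → Disjoint xs zs → Disjoint xs (ys ++ zs)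
disjoint-++ʳ ys apart₁ apart₂ = disjoint-sym (disjoint-++ˡ ys (disjoint-sym apart₁) (disjoint-sym apart₂))

disjoint-⊆ : ∀ {A : Set} {xs xs′ ys ys′ : List A} →
             xs ⊆ xs′ → ys ⊆ ys′ → Disjoint xs′ ys′ → Disjoint xs ys
disjoint-⊆ sub₁ sub₂ apart k l = apart (sub₁ k) (sub₂ l)

nonEmpty : ∀ {A : Set} (xs : List A) → xs ≢ [] → ∃ λ x → x ∈ xs
nonEmpty []      xs≢[] = ⊥-elim (xs≢[] refl)
nonEmpty (x ∷ _) _     = x , here refl

sumFin : ∀ {m} → (Fin m → ℕ) → ℕ
sumFin g = sum (tabulate g)

dropAt : ∀ {m} → Fin m → (Fin m → ℕ) → Fin m → ℕ
dropAt x g y = if does (y ≟ x) then 0 else g y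

dropAt-other : ∀ {m} (g : Fin m → ℕ) {x y} → y ≢ x → dropAt x g y ≡ g y
dropAt-other g {x} {y} y≢x with y ≟ x
... | yes y≡x = ⊥-elim (y≢x y≡x)
... | no _    = refl

sumFin-isolate : ∀ {m} (g : Fin m → ℕ) x → sumFin g ≡ g x + sumFin (dropAt x g)
sumFin-isolate {suc m} g Fin.zero    = refl
sumFin-isolate {suc m} g (Fin.suc x) = begin
  g₀ + sumFin (g ∘ Fin.suc)                     ≡⟨ cong (g₀ +_) (sumFin-isolate (g ∘ Fin.suc) x) ⟩
  g₀ + (g (Fin.suc x) + rest)                   ≡⟨ sym (+-assoc g₀ (g (Fin.suc x)) rest) ⟩
  (g₀ + g (Fin.suc x)) + rest                   ≡⟨ cong (_+ rest) (+-comm g₀ (g (Fin.suc x))) ⟩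
  (g (Fin.suc x) + g₀) + rest                   ≡⟨ +-assoc (g (Fin.suc x)) g₀ rest ⟩
  g (Fin.suc x) + (g₀ + rest)                   ∎
  where
  open ≡-Reasoning
  g₀ = g Fin.zero
  rest = sumFin (dropAt x (g ∘ Fin.suc))

threeParents : ∀ {n} (E : Graph n) {a b c v} → a ≢ b → a ≢ c → b ≢ c →
               Arc E a v → Arc E b v → Arc E c v → 3 ≤ indeg E v
threeParents {n} E {a} {b} {c} {v} a≢b a≢c b≢c ea eb ec =
  subst (3 ≤_) (sym indeg≡) (s≤s (s≤s (s≤s z≤n)))
  where
  open ≡-Reasoning
  f : Fin n → ℕ
  f u = if E u v then 1 else 0
  parent : ∀ {u} → Arc E u v → f u ≡ 1
  parent e = cong (λ isArc → if isArc then 1 else 0) e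
  f₁ = dropAt a f
  f₂ = dropAt b f₁
  indeg≡ : indeg E v ≡ 3 + sumFin (dropAt c f₂)
  indeg≡ = begin
    indeg E v                        ≡⟨ cong sum (map-tabulate id f) ⟩
    sumFin f                         ≡⟨ sumFin-isolate f a ⟩
    f a + sumFin f₁                  ≡⟨ cong (_+ sumFin f₁) (parent ea) ⟩
    1 + sumFin f₁                    ≡⟨ cong suc (sumFin-isolate f₁ b) ⟩
    1 + (f₁ b + sumFin f₂)           ≡⟨ cong (λ k → 1 + (k + sumFin f₂)) (trans (dropAt-other f (≢-sym a≢b)) (parent eb)) ⟩
    2 + sumFin f₂                    ≡⟨ cong (2 +_) (sumFin-isolate f₂ c) ⟩
    2 + (f₂ c + sumFin (dropAt c f₂)) ≡⟨ cong (λ k → 2 + (k + sumFin (dropAt c f₂)))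
                                          (trans (dropAt-other f₁ (≢-sym b≢c))
                                          (trans (dropAt-other f (≢-sym a≢c)) (parent ec))) ⟩
    3 + sumFin (dropAt c f₂)         ∎

module Paths {n : ℕ} (E : Graph n) where

  private
    variable
      x y z u w s s′ m a b : Fin n
      I J K L R : List (Fin n)

  join : Path E x z I → Path E z y J → Path E x y (I ++ z ∷ J)
  join (arc e)    q = step e q
  join (step e p) q = step e (join p q)

  arcOf : Path E x y I → (u , w) ∈ arcsOf x y I → Arc E u w
  arcOf (arc e)    (here refl) = e
  arcOf (step e p) (here refl) = e
  arcOf (step e p) (there k)   = arcOf p k

  arcHead : ∀ I → (u , w) ∈ arcsOf x y I → w ∈ I ⊎ w ≡ y
  arcHead []      (here refl) = inj₂ refl
  arcHead (z ∷ I) (here refl) = inj₁ (here refl)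
  arcHead (z ∷ I) (there k)   = Sum.map₁ there (arcHead I k)

  arcInto : ∀ I → m ∈ I → ∃ λ a → (a , m) ∈ arcsOf x y I
  arcInto {x = x} (z ∷ I) (here refl) = x , here refl
  arcInto         (z ∷ I) (there k)   = let a , k′ = arcInto I k in a , there k′

  prefixTo : Path E x y I → m ∈ I → ∃ λ A → Path E x m A
  prefixTo (step e p) (here refl) = [] , arc e
  prefixTo (step e p) (there k)   = let A , q = prefixTo p k in _ ∷ A , step e q

  -- Walk x y L: a possibly trivial directed walk from x to y, where L lists the
  -- nodes visited after x (so L ends with y unless the walk is trivial).
  data Walk : Fin n → Fin n → List (Fin n) → Set where
    []  : Walk x x []
    _∷_ : Arc E x z → Walk z y L → Walk x y (z ∷ L)

  -- CoWalk x y L: the same, but L lists the nodes visited before y.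
  data CoWalk : Fin n → Fin n → List (Fin n) → Set where
    []  : CoWalk x x []
    _∷_ : Arc E x z → CoWalk z y L → CoWalk x y (x ∷ L)

  walkEnd∈ : Walk x y (z ∷ L) → y ∈ z ∷ L
  walkEnd∈ (e ∷ [])      = here refl
  walkEnd∈ (e ∷ (f ∷ w)) = there (walkEnd∈ (f ∷ w))

  trivialOrVisits : Walk x y L → (x ≡ y × L ≡ []) ⊎ y ∈ L
  trivialOrVisits []        = inj₁ (refl , refl)
  trivialOrVisits w@(_ ∷ _) = inj₂ (walkEnd∈ w)

  snoc : Walk x u L → Arc E u y → Walk x y (L ++ y ∷ [])
  snoc []      e = e ∷ []
  snoc (f ∷ w) e = f ∷ snoc w e

  unsnoc : Walk x y (z ∷ L) → ∃ λ K → ∃ λ u → Walk x u K × Arc E u y × z ∷ L ≡ K ++ y ∷ []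
  unsnoc (e ∷ [])      = [] , _ , [] , e , refl
  unsnoc (e ∷ (f ∷ w)) = let K , u , w′ , f′ , eq = unsnoc (f ∷ w) in
                         _ ∷ K , u , e ∷ w′ , f′ , cong (_ ∷_) eq

  dropWalk : ∀ K → Walk x y (K ++ m ∷ L) → Walk m y L
  dropWalk []      (e ∷ w) = w
  dropWalk (k ∷ K) (e ∷ w) = dropWalk K w

  extend : Walk x u L → Arc E u y → Path E x y L
  extend []      e = arc e
  extend (f ∷ w) e = step f (extend w e)

  extend-last : Walk x u L → (u , y) ∈ arcsOf x y L
  extend-last []      = here refl
  extend-last (f ∷ w) = there (extend-last w)

  penultimate : Path E x y I → ∃ λ u → Walk x u I × Arc E u y
  penultimate (arc e)    = _ , [] , e
  penultimate (step e p) = let u , w , f = penultimate p in u , e ∷ w , f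

  prepend : Walk x u L → Path E u y I → Path E x y (L ++ I)
  prepend []      p = p
  prepend (e ∷ w) p = step e (prepend w p)

  arcThen : Arc E x z → CoWalk z y R → Path E x y R
  arcThen e []      = arc e
  arcThen e (f ∷ c) = step e (arcThen f c)

  append : Path E x u I → CoWalk u y R → Path E x y (I ++ R)
  append {I = I} p [] = subst (Path E _ _) (sym (++-identityʳ I)) p
  append         p (e ∷ c) = join p (arcThen e c)

  toCoWalk : Path E x y I → CoWalk x y (x ∷ I)
  toCoWalk (arc e)    = e ∷ []
  toCoWalk (step e p) = e ∷ toCoWalk p

  record ArcSplit (x y u w : Fin n) (I : List (Fin n)) : Set where
    field
      {before after} : List (Fin n)
      prefix  : Walk x u before
      suffix  : CoWalk w y after
      before⊆ : before ⊆ I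
      after⊆  : after ⊆ I

  splitAtArc : Path E x y I → (u , w) ∈ arcsOf x y I → ArcSplit x y u w I
  splitAtArc (arc e)    (here refl) = record
    { prefix = [] ; suffix = [] ; before⊆ = λ () ; after⊆ = λ () }
  splitAtArc (step e p) (here refl) = record
    { prefix = [] ; suffix = toCoWalk p ; before⊆ = λ () ; after⊆ = id }
  splitAtArc (step e p) (there k)   = record
    { prefix = e ∷ prefix ; suffix = suffix
    ; before⊆ = λ { (here refl) → here refl ; (there l) → there (before⊆ l) }
    ; after⊆ = there ∘ after⊆ }
    where open ArcSplit (splitAtArc p k)

  TreeNodes : List (Fin n) → Set
  TreeNodes I = ∀ {m a b} → m ∈ I → Arc E a m → Arc E b m → a ≡ b

  OneIsTail : Fin n → Fin n → List (Fin n) → List (Fin n) → Set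
  OneIsTail s s′ I J = (∃ λ A → Walk s s′ A × I ≡ A ++ J) ⊎ (∃ λ B → Walk s′ s B × J ≡ B ++ I)

  -- Tracing two walks back from a common last node, they stay together as long
  -- as the first visits tree nodes, so one of them ends up a tail of the other.
  tails : TreeNodes I → Walk s x I → Walk s′ x J → OneIsTail s s′ I J
  tails {I = I} tree p []      = inj₁ (I , p , sym (++-identityʳ I))
  tails         tree p (e ∷ q) with tails tree p q
  ... | inj₂ (B , w , refl)      = inj₂ (_ ∷ B , e ∷ w , refl)
  ... | inj₁ ([] , [] , refl)    = inj₂ (_ ∷ [] , e ∷ [] , refl)
  ... | inj₁ (z ∷ A , w , refl)  with unsnoc w
  ...   | K , u , w′ , f , eq    = inj₁ (K , subst (λ v → Walk _ v K) (tree z∈I f e) w′ , I≡)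
    where
    I≡ : (z ∷ A) ++ _ ≡ K ++ _
    I≡ = trans (cong (_++ _) eq) (++-assoc K _ _)
    z∈I : _ ∈ (z ∷ A) ++ _
    z∈I = subst (_ ∈_) (sym I≡) (∈-++⁺ʳ K (here refl))

  tailCases : OneIsTail s s′ I J → (s ≡ s′ × I ≡ J) ⊎ s′ ∈ I ⊎ s ∈ J
  tailCases (inj₁ ([] , [] , eq))      = inj₁ (refl , eq)
  tailCases (inj₁ (_ ∷ _ , w , refl)) = inj₂ (inj₁ (∈-++⁺ˡ (walkEnd∈ w)))
  tailCases (inj₂ ([] , [] , eq))      = inj₁ (refl , sym eq)
  tailCases (inj₂ (_ ∷ _ , w , refl)) = inj₂ (inj₂ (∈-++⁺ˡ (walkEnd∈ w)))

  record Fork (a b : Fin n) : Set where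
    field
      base : Fin n
      {left right} : List (Fin n)
      toA : Walk base a left
      toB : Walk base b right
      apart : Disjoint left right

  open DecMembership (_≟_ {n}) using (_∈?_)

  lastIn : Walk x a L → (K : List (Fin n)) →
           Disjoint L K ⊎ ∃ λ m → m ∈ K × ∃ λ B → Walk m a B × Disjoint B K
  lastIn []                K = inj₁ (λ ())
  lastIn (_∷_ {z = z} e w) K with lastIn w K
  ... | inj₂ found = inj₂ found
  ... | inj₁ apart with z ∈? K
  ...   | yes z∈K = inj₂ (z , z∈K , _ , w , apart)
  ...   | no  z∉K = inj₁ λ { (here refl) → z∉K ; (there k) → apart k }

  -- Two walks from a common node fork at the last node of the first one that
  -- the second visits.
  fork : Walk x a L → Walk x b K → Fork a b
  fork wa wb with lastIn wa _
  ... | inj₁ apart = record { toA = wa ; toB = wb ; apart = apart }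
  ... | inj₂ (m , m∈K , B , wm , apart) with ∈-∃++ m∈K
  ...   | K₁ , K₂ , refl = record
          { toA = wm ; toB = dropWalk K₁ wb ; apart = λ k l → apart k (∈-++⁺ʳ K₁ (there l)) }

  forkDistinct : a ≢ b → Walk x a L → Walk x b K → Disjoint L K → L ≢ K
  forkDistinct a≢b []      []      _     _  = a≢b refl
  forkDistinct _   []      (_ ∷ _) _     ()
  forkDistinct _   (_ ∷ _) _       apart eq = apart (here refl) (subst (_ ∈_) eq (here refl))

  module Acyclicity (acyclic : Acyclic E) where

    noEnd : Path E x y I → y ∈ I → ⊥
    noEnd (step e p) (here refl) = acyclic _ _ p
    noEnd (step e p) (there k)   = noEnd p k

    noStart : Path E x y I → x ∈ I → ⊥
    noStart p k = acyclic _ _ (proj₂ (prefixTo p k))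

    crossingStarts : Path E s y I → Path E s′ z J → s′ ∈ I → s ∈ J → ⊥
    crossingStarts p q k l = acyclic _ _ (join (proj₂ (prefixTo p k)) (proj₂ (prefixTo q l)))

    lastArc : Path E x y I → (u , y) ∈ arcsOf x y I → Walk x u I
    lastArc (arc e)    (here refl) = []
    lastArc (step e p) (here refl) = ⊥-elim (acyclic _ _ p)
    lastArc (step e p) (there k)   = e ∷ lastArc p k

    finalNodesDiffer : Path E s y I → Path E s z J → I ≢ J → Disjoint I J →
                       Walk s u I → Walk s w J → u ≢ w
    finalNodesDiffer p q I≢J _     []        []        refl = I≢J refl
    finalNodesDiffer p q _   _     []        w@(_ ∷ _) refl = noStart q (walkEnd∈ w)
    finalNodesDiffer p q _   _     w@(_ ∷ _) []        refl = noStart p (walkEnd∈ w)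
    finalNodesDiffer p q _   apart w@(_ ∷ _) w′@(_ ∷ _) refl = apart (walkEnd∈ w) (walkEnd∈ w′)

    _⊏_ : Fin n → Fin n → Set
    u ⊏ v = ∃ λ I → Path E u v I

    ⊏-wellFounded : WellFounded _⊏_
    ⊏-wellFounded = spo-wellFounded record
      { isEquivalence = isEquivalence
      ; irrefl        = λ { refl (I , p) → acyclic _ I p }
      ; trans         = λ { (I , p) (J , q) → _ , join p q }
      ; <-resp-≈      = (λ { refl p → p }) , (λ { refl p → p }) }

    parentIn : ∀ L → sum (map (λ u → if E u y then 1 else 0) L) ≢ 0 → ∃ λ u → Arc E u y
    parentIn []      nz = ⊥-elim (nz refl)
    parentIn {y = y} (u ∷ L) nz with E u y in eq
    ... | true  = u , eq
    ... | false = parentIn L nz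

    reachableFrom : ∀ r → (∀ v → indeg E v ≡ 0 → v ≡ r) → ∀ v → ∃ λ L → Walk r v L
    reachableFrom r source v = go v (⊏-wellFounded v)
      where
      go : ∀ v → Acc _⊏_ v → ∃ λ L → Walk r v L
      go v (acc below) with v ≟ r
      ... | yes refl = [] , []
      ... | no v≢r with parentIn (allFin n) (v≢r ∘ source v)
      ...   | u , e = let L , w = go u (below ([] , arc e)) in L ++ v ∷ [] , snoc w e

module Cycles {X : Set} (N : EvolNet X) where
  open EvolNet N
  open RetCycle
  open Paths E
  open Acyclicity acyclic

  private
    variable
      a b h m u v : Fin n
      L R : List (Fin n)

  swap : RetCycle N → RetCycle N
  swap C = record
    { split = split C ; end = end C ; int₁ = int₂ C ; int₂ = int₁ C
    ; path₁ = path₂ C ; path₂ = path₁ C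
    ; distinct = distinct C ∘ sym ; noCommon = disjoint-sym (noCommon C) }

  swapSame : (C D : RetCycle N) → SameCycle N C (swap D) → SameCycle N C D
  swapSame C D (ss , ee , inj₁ (e₁ , e₂)) = ss , ee , inj₂ (e₁ , e₂)
  swapSame C D (ss , ee , inj₂ (e₁ , e₂)) = ss , ee , inj₁ (e₁ , e₂)

  sameEnd : (C D : RetCycle N) → SameCycle N C D → end C ≡ end D
  sameEnd C D = proj₁ ∘ proj₂

  cycle : ∀ {s h I J} → Path E s h I → Path E s h J → m ∈ I → Disjoint I J → RetCycle N
  cycle p q k apart = record
    { split = _ ; end = _ ; int₁ = _ ; int₂ = _ ; path₁ = p ; path₂ = q
    ; distinct = λ eq → apart k (subst (_ ∈_) eq k) ; noCommon = apart }

  interiorNotEnd : (C : RetCycle N) → m ∈ intermediates N C → m ≢ end C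
  interiorNotEnd C k refl with ∈-++⁻ (int₁ C) k
  ... | inj₁ k₁ = noEnd (path₁ C) k₁
  ... | inj₂ k₂ = noEnd (path₂ C) k₂

  enteringArc : (C : RetCycle N) → m ∈ intermediates N C → ∃ λ a → (a , m) ∈ arcs N C
  enteringArc C k with ∈-++⁻ (int₁ C) k
  ... | inj₁ k₁ = let a , l = arcInto (int₁ C) k₁ in a , ∈-++⁺ˡ l
  ... | inj₂ k₂ = let a , l = arcInto (int₂ C) k₂ in a , ∈-++⁺ʳ _ l

  arcOfCycle : (C : RetCycle N) → (a , m) ∈ arcs N C → Arc E a m
  arcOfCycle C k with ∈-++⁻ (arcsOf (split C) (end C) (int₁ C)) k
  ... | inj₁ k₁ = arcOf (path₁ C) k₁
  ... | inj₂ k₂ = arcOf (path₂ C) k₂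

  reach : ∀ v → ∃ λ L → Walk root v L
  reach = reachableFrom root root-unique

  hybridCycle : a ≢ b → Arc E a v → Arc E b v → Σ (RetCycle N) λ F → end F ≡ v × (a , v) ∈ arcs N F
  hybridCycle a≢b ea eb with fork (proj₂ (reach _)) (proj₂ (reach _))
  ... | record { toA = wa ; toB = wb ; apart = apart } =
        record { split = _ ; end = _ ; int₁ = _ ; int₂ = _
               ; path₁ = extend wa ea ; path₂ = extend wb eb
               ; distinct = forkDistinct a≢b wa wb apart ; noCommon = apart }
        , refl , ∈-++⁺ˡ (extend-last wa)

  -- Rerouting, when the first side of C is the single arc (split C , end C)
  -- and this arc lies on the first side of D: going along D through the
  -- second side of C instead yields a cycle ending at end D that shares the
  -- interior of the second side of C.
  rerouteAtSplit : OneNested N → (C D : RetCycle N) → end C ≢ end D → int₁ C ≡ [] →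
                   Walk (split D) (split C) L → CoWalk (end C) (end D) R →
                   L ⊆ int₁ D → R ⊆ int₁ D → ⊥
  rerouteAtSplit {L = L} nested C D h≢h′ I₁≡[] w c L⊆J₁ R⊆J₁ =
    nested C′ C (≢-sym h≢h′) (∈-++⁺ˡ z∈path) (∈-++⁺ʳ (int₁ C) z∈I₂)
    where
    C#D = nested C D h≢h′
    I₂ = int₂ C
    z∈I₂ = proj₂ (nonEmpty I₂ (λ I₂≡[] → distinct C (trans I₁≡[] (sym I₂≡[]))))
    z∈path = ∈-++⁺ʳ L (∈-++⁺ˡ z∈I₂)
    apart : Disjoint (L ++ (I₂ ++ _)) (int₂ D)
    apart = disjoint-++ˡ L (disjoint-⊆ L⊆J₁ id (noCommon D))
              (disjoint-++ˡ I₂ (disjoint-⊆ (∈-++⁺ʳ (int₁ C)) (∈-++⁺ʳ (int₁ D)) C#D)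
                               (disjoint-⊆ R⊆J₁ id (noCommon D)))
    C′ = cycle (prepend w (append (path₂ C) c)) (path₂ D) z∈path apart

  -- Rerouting, when split D is interior to the first side of C and the arc
  -- from it to end C is on the first side of D: combining the first side of C
  -- with the second side of D, and the second side of C with the rest of the
  -- first side of D, yields a cycle ending at end D through split D.
  rerouteFromInterior : OneNested N → (C D : RetCycle N) → end C ≢ end D →
                        Walk (split C) (split D) (int₁ C) → split D ∈ int₁ C →
                        CoWalk (end C) (end D) R → R ⊆ int₁ D → ⊥
  rerouteFromInterior nested C D h≢h′ w k c R⊆J₁ =
    nested C′ C (≢-sym h≢h′) (∈-++⁺ˡ (∈-++⁺ˡ k)) (∈-++⁺ˡ k)
    where
    C#D = nested C D h≢h′
    apart : Disjoint (int₁ C ++ int₂ D) (int₂ C ++ _)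
    apart = disjoint-++ˡ (int₁ C)
              (disjoint-++ʳ (int₂ C) (noCommon C) (disjoint-⊆ ∈-++⁺ˡ (∈-++⁺ˡ ∘ R⊆J₁) C#D))
              (disjoint-++ʳ (int₂ C) (disjoint-⊆ (∈-++⁺ʳ (int₁ D)) (∈-++⁺ʳ (int₁ C)) (disjoint-sym C#D))
                                     (disjoint-sym (disjoint-⊆ R⊆J₁ id (noCommon D))))
    C′ = cycle (prepend w (path₂ D)) (append (path₂ C) c) (∈-++⁺ˡ k) apart

  finalArcNotShared : OneNested N → (C D : RetCycle N) → end C ≢ end D →
                      (u , end C) ∈ arcsOf (split C) (end C) (int₁ C) →
                      (u , end C) ∈ arcsOf (split D) (end D) (int₁ D) → ⊥
  finalArcNotShared nested C D h≢h′ inC inD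
    with lastArc (path₁ C) inC | splitAtArc (path₁ D) inD
  ... | wC | record { prefix = wD ; suffix = c ; before⊆ = L⊆J₁ ; after⊆ = R⊆J₁ }
    with trivialOrVisits wC | trivialOrVisits wD
  ... | inj₂ u∈I₁           | inj₂ u∈L = nested C D h≢h′ (∈-++⁺ˡ u∈I₁) (∈-++⁺ˡ (L⊆J₁ u∈L))
  ... | inj₁ (refl , I₁≡[]) | _        = rerouteAtSplit nested C D h≢h′ I₁≡[] wD c L⊆J₁ R⊆J₁
  ... | inj₂ u∈I₁           | inj₁ (refl , _) = rerouteFromInterior nested C D h≢h′ wC u∈I₁ c R⊆J₁

  -- Sides of cycles with different ends share no arc: the head of a shared arc
  -- would be interior to both, or the end of one of them.
  sidesArcDisjoint : OneNested N → (C D : RetCycle N) → end C ≢ end D →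
                     Disjoint (arcsOf (split C) (end C) (int₁ C)) (arcsOf (split D) (end D) (int₁ D))
  sidesArcDisjoint nested C D h≢h′ {u , w} inC inD with arcHead (int₁ C) inC | arcHead (int₁ D) inD
  ... | inj₁ w∈I₁ | inj₁ w∈J₁ = nested C D h≢h′ (∈-++⁺ˡ w∈I₁) (∈-++⁺ˡ w∈J₁)
  ... | inj₂ refl | _         = finalArcNotShared nested C D h≢h′ inC inD
  ... | inj₁ _    | inj₂ refl = finalArcNotShared nested D C (≢-sym h≢h′) inD inC

  arcDisjoint : OneNested N → (C D : RetCycle N) → end C ≢ end D → Disjoint (arcs N C) (arcs N D)
  arcDisjoint nested C D h≢h′ inC inD
    with ∈-++⁻ (arcsOf (split C) (end C) (int₁ C)) inC | ∈-++⁻ (arcsOf (split D) (end D) (int₁ D)) inD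
  ... | inj₁ k | inj₁ l = sidesArcDisjoint nested C D h≢h′ k l
  ... | inj₂ k | inj₁ l = sidesArcDisjoint nested (swap C) D h≢h′ k l
  ... | inj₁ k | inj₂ l = sidesArcDisjoint nested C (swap D) h≢h′ k l
  ... | inj₂ k | inj₂ l = sidesArcDisjoint nested (swap C) (swap D) h≢h′ k l

  -- In a 1-nested network an arc of a cycle entering an interior node m is the
  -- only arc entering m: a second one would make m the end of a cycle sharing
  -- that arc.
  onlyParent : OneNested N → (C : RetCycle N) → m ∈ intermediates N C →
               (b , m) ∈ arcs N C → Arc E a m → a ≡ b
  onlyParent {b = b} {a = a} nested C k bC ea with a ≟ b
  ... | yes a≡b = a≡b
  ... | no a≢b with hybridCycle (≢-sym a≢b) (arcOfCycle C bC) ea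
  ...   | F , refl , bF = ⊥-elim (arcDisjoint nested F C (interiorNotEnd C k) bF bC)

  interiorTreeNodes : OneNested N → (C : RetCycle N) → TreeNodes (intermediates N C)
  interiorTreeNodes nested C k ea eb with enteringArc C k
  ... | c , cC = trans (onlyParent nested C k cC ea) (sym (onlyParent nested C k cC eb))

  otherParent : TwoHybrid N → a ≢ b → Arc E a h → Arc E b h → Arc E v h → v ≡ a ⊎ v ≡ b
  otherParent {a = a} {b = b} {v = v} twoHybrid a≢b ea eb ev with v ≟ a | v ≟ b
  ... | yes v≡a | _       = inj₁ v≡a
  ... | no _    | yes v≡b = inj₂ v≡b
  ... | no v≢a  | no v≢b  = ⊥-elim (n≮n 2 (subst (3 ≤_) (twoHybrid _ (≤-trans (s≤s (s≤s z≤n)) three)) three))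
    where
    three = threeParents E a≢b (≢-sym v≢a) (≢-sym v≢b) ea eb ev

  -- In a 1-nested network, two cycles with the same end whose corresponding
  -- sides enter it from the same nodes coincide: traced backwards the sides
  -- agree, and any other outcome contradicts acyclicity or disjointness.
  sameFinalArcs : OneNested N → (C D : RetCycle N) → end C ≡ end D →
                  Walk (split C) u (int₁ C) → Walk (split D) u (int₁ D) →
                  Walk (split C) v (int₂ C) → Walk (split D) v (int₂ D) → SameCycle N C D
  sameFinalArcs nested C D h≡h′ w₁ w₁′ w₂ w₂′ =
    combine (tailCases (tails (λ k → tree (∈-++⁺ˡ k)) w₁ w₁′))
            (tailCases (tails (λ k → tree (∈-++⁺ʳ (int₁ C) k)) w₂ w₂′))
    where
    tree = interiorTreeNodes nested C
    s = split C
    s′ = split D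
    combine : (s ≡ s′ × int₁ C ≡ int₁ D) ⊎ s′ ∈ int₁ C ⊎ s ∈ int₁ D →
              (s ≡ s′ × int₂ C ≡ int₂ D) ⊎ s′ ∈ int₂ C ⊎ s ∈ int₂ D → SameCycle N C D
    combine (inj₁ (s≡s′ , e₁)) (inj₁ (_ , e₂)) = s≡s′ , h≡h′ , inj₁ (e₁ , e₂)
    combine (inj₁ (s≡s′ , _)) (inj₂ (inj₁ k))  = ⊥-elim (noStart (path₂ C) (subst (_∈ int₂ C) (sym s≡s′) k))
    combine (inj₁ (s≡s′ , _)) (inj₂ (inj₂ l))  = ⊥-elim (noStart (path₂ D) (subst (_∈ int₂ D) s≡s′ l))
    combine (inj₂ (inj₁ k)) (inj₁ (s≡s′ , _))  = ⊥-elim (noStart (path₁ C) (subst (_∈ int₁ C) (sym s≡s′) k))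
    combine (inj₂ (inj₂ l)) (inj₁ (s≡s′ , _))  = ⊥-elim (noStart (path₁ D) (subst (_∈ int₁ D) s≡s′ l))
    combine (inj₂ (inj₁ k)) (inj₂ (inj₁ k′))   = ⊥-elim (noCommon C k k′)
    combine (inj₂ (inj₂ l)) (inj₂ (inj₂ l′))   = ⊥-elim (noCommon D l l′)
    combine (inj₂ (inj₁ k)) (inj₂ (inj₂ l))    = ⊥-elim (crossingStarts (path₁ C) (path₂ D) k l)
    combine (inj₂ (inj₂ l)) (inj₂ (inj₁ k))    = ⊥-elim (crossingStarts (path₂ C) (path₁ D) k l)

  -- In a 1-nested 2-hybrid network each node ends at most one cycle: the end
  -- has exactly two parents, through which both sides of each cycle enter it.
  uniqueCycle : TwoHybrid N → OneNested N → (C D : RetCycle N) → end C ≡ end D → SameCycle N C D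
  uniqueCycle twoHybrid nested C D h≡h′
    with penultimate (path₁ C) | penultimate (path₂ C) | penultimate (path₁ D) | penultimate (path₂ D)
  ... | u₁ , w₁ , e₁ | u₂ , w₂ , e₂ | v₁ , w₁′ , f₁ | v₂ , w₂′ , f₂
    with otherParent twoHybrid u₁≢u₂ e₁ e₂ (subst (Arc E v₁) (sym h≡h′) f₁)
       | otherParent twoHybrid u₁≢u₂ e₁ e₂ (subst (Arc E v₂) (sym h≡h′) f₂)
    where
    u₁≢u₂ = finalNodesDiffer (path₁ C) (path₂ C) (distinct C) (noCommon C) w₁ w₂
  ... | inj₁ refl | inj₂ refl = sameFinalArcs nested C D h≡h′ w₁ w₁′ w₂ w₂′
  ... | inj₂ refl | inj₁ refl = swapSame C D (sameFinalArcs nested C (swap D) h≡h′ w₁ w₂′ w₂ w₁′)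
  ... | inj₁ refl | inj₁ refl = ⊥-elim (finalNodesDiffer (path₁ D) (path₂ D) (distinct D) (noCommon D) w₁′ w₂′ refl)
  ... | inj₂ refl | inj₂ refl = ⊥-elim (finalNodesDiffer (path₁ D) (path₂ D) (distinct D) (noCommon D) w₁′ w₂′ refl)

  -- Distinct cycles have different ends, hence share no arc.
  oneNested⇒weaklyGalled : TwoHybrid N → OneNested N → WeaklyGalledTree N
  oneNested⇒weaklyGalled twoHybrid nested C D notSame with end C ≟ end D
  ... | yes h≡h′ = ⊥-elim (notSame (uniqueCycle twoHybrid nested C D h≡h′))
  ... | no h≢h′  = arcDisjoint nested C D h≢h′

  -- A node interior to cycles C, D with different ends is entered by an arc of
  -- each; equal arcs are shared by C and D, distinct ones make the node the end
  -- of a cycle sharing an arc with C.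
  weaklyGalled⇒oneNested : WeaklyGalledTree N → OneNested N
  weaklyGalled⇒oneNested galled C D h≢h′ kC kD with enteringArc C kC | enteringArc D kD
  ... | a , aC | b , bD with a ≟ b
  ...   | yes refl = galled C D (λ same → h≢h′ (sameEnd C D same)) aC bD
  ...   | no a≢b with hybridCycle a≢b (arcOfCycle C aC) (arcOfCycle D bD)
  ...     | F , refl , aF = galled F C (λ same → interiorNotEnd C kC (sameEnd F C same)) aF aC

proposition3 : ∀ {X : Set} (N : EvolNet X) → TwoHybrid N → (OneNested N ⇔ WeaklyGalledTree N)
proposition3 N twoHybrid =
  mk⇔ (oneNested⇒weaklyGalled twoHybrid) weaklyGalled⇒oneNested
  where open Cycles N
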